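{- Let $h \geq 1$ be an integer, $q_0 := 2^h$, $q := 2q_0^2$, and $S := \langle q,\ q+q_0,\ q+2q_0,\ q+2q_0+1\rangle$. Then $$S = \{\lambda_1 q + \lambda_2 q_0 + \lambda_3 : \lambda_1,\lambda_2,\lambda_3 \in \mathbb{N},\ 0 \leq 2\lambda_3 \leq \lambda_2 \leq 2\lambda_1\}.$$
   Context: $\mathbb{N} = \{0,1,2,\ldots\}$; $\langle a_1,\ldots,a_k\rangle$ denotes the set of all $\mathbb{N}$-linear combinations of $a_1,\ldots,a_k$. -}

module Defs where

open import Data.Nat using (ℕ; _+_; _*_; _^_; _≤_)
open import Data.Product using (∃-syntax; _×_)
open import Relation.Binary.PropositionalEquality using (_≡_)

q₀ : ℕ → ℕ
q₀ h = 2 ^ h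

qq : ℕ → ℕ
qq h = 2 * (q₀ h * q₀ h)

InS : ℕ → ℕ → Set
InS h n = ∃[ a ] ∃[ b ] ∃[ c ] ∃[ d ]
  (n ≡ a * qq h + b * (qq h + q₀ h) + c * (qq h + 2 * q₀ h)
         + d * (qq h + 2 * q₀ h + 1))

InT : ℕ → ℕ → Set
InT h n = ∃[ l₁ ] ∃[ l₂ ] ∃[ l₃ ]
  ((n ≡ l₁ * qq h + l₂ * q₀ h + l₃) × (2 * l₃ ≤ l₂) × (l₂ ≤ 2 * l₁))

-- The map (a, b, c, d) ↦ (a + b + c + d, b + 2c + 2d, d) rewrites a combination
-- a q + b (q + q₀) + c (q + 2q₀) + d (q + 2q₀ + 1) as λ₁ q + λ₂ q₀ + λ₃ with
-- 2λ₃ ≤ λ₂ ≤ 2λ₁. Conversely, while λ₂ ≥ 2 one peels off a generator q + 2q₀ or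
-- q + 2q₀ + 1, lowering (λ₁, λ₂, λ₃) by (1, 2, 0) or (1, 2, 1) within the same
-- triangle; λ₂ ≤ 1 leaves q + q₀ at most once plus copies of q. Nothing depends
-- on q₀ being a power of 2.
module Submission where

open import Defs
open import Data.Nat using (ℕ; zero; suc; _+_; _*_; _≤_; z≤n; s≤s)
open import Data.Nat.Properties using (*-suc; +-cancelˡ-≤; m≤m+n; m≤n+m)
open import Data.Nat.Tactic.RingSolver using (solve-∀)
open import Data.Product using (∃-syntax; _×_; _,_)
open import Data.Empty using (⊥)
open import Relation.Binary.PropositionalEquality using (_≡_; refl; subst)

2*suc-≤-2+⇒2*-≤ : ∀ k m → 2 * suc k ≤ 2 + m → 2 * k ≤ m
2*suc-≤-2+⇒2*-≤ k m le = +-cancelˡ-≤ 2 (2 * k) m (subst (_≤ 2 + m) (*-suc 2 k) le)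

2+-≤-2*suc⇒≤-2* : ∀ m p → 2 + m ≤ 2 * suc p → m ≤ 2 * p
2+-≤-2*suc⇒≤-2* m p le = +-cancelˡ-≤ 2 m (2 * p) (subst (2 + m ≤_) (*-suc 2 p) le)

2*suc-≰-1 : ∀ k → 2 * suc k ≤ 1 → ⊥
2*suc-≰-1 k le with subst (_≤ 1) (*-suc 2 k) le
... | s≤s ()

module Generators (q q₀ : ℕ) where

  Generated : ℕ → Set
  Generated n = ∃[ a ] ∃[ b ] ∃[ c ] ∃[ d ]
    (n ≡ a * q + b * (q + q₀) + c * (q + 2 * q₀) + d * (q + 2 * q₀ + 1))

  Triangular : ℕ → Set
  Triangular n = ∃[ l₁ ] ∃[ l₂ ] ∃[ l₃ ]
    ((n ≡ l₁ * q + l₂ * q₀ + l₃) × (2 * l₃ ≤ l₂) × (l₂ ≤ 2 * l₁))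

  generated-+ : ∀ {m n} → Generated m → Generated n → Generated (m + n)
  generated-+ (a , b , c , d , refl) (a′ , b′ , c′ , d′ , refl) =
    a + a′ , b + b′ , c + c′ , d + d′ , combination-+ a b c d a′ b′ c′ d′ q q₀
    where
    combination-+ : ∀ a b c d a′ b′ c′ d′ q q₀ →
      a * q + b * (q + q₀) + c * (q + 2 * q₀) + d * (q + 2 * q₀ + 1)
        + (a′ * q + b′ * (q + q₀) + c′ * (q + 2 * q₀) + d′ * (q + 2 * q₀ + 1))
      ≡ (a + a′) * q + (b + b′) * (q + q₀) + (c + c′) * (q + 2 * q₀)
        + (d + d′) * (q + 2 * q₀ + 1)
    combination-+ = solve-∀

  generated-q+2q₀ : Generated (q + 2 * q₀)
  generated-q+2q₀ = 0 , 0 , 1 , 0 , unit-c q q₀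
    where
    unit-c : ∀ q q₀ →
      q + 2 * q₀ ≡ 0 * q + 0 * (q + q₀) + 1 * (q + 2 * q₀) + 0 * (q + 2 * q₀ + 1)
    unit-c = solve-∀

  generated-q+2q₀+1 : Generated (q + 2 * q₀ + 1)
  generated-q+2q₀+1 = 0 , 0 , 0 , 1 , unit-d q q₀
    where
    unit-d : ∀ q q₀ →
      q + 2 * q₀ + 1 ≡ 0 * q + 0 * (q + q₀) + 0 * (q + 2 * q₀) + 1 * (q + 2 * q₀ + 1)
    unit-d = solve-∀

  generated⇒triangular : ∀ {n} → Generated n → Triangular n
  generated⇒triangular (a , b , c , d , refl) =
    a + b + c + d , b + 2 * c + 2 * d , d ,
    regroup a b c d q q₀ , m≤n+m (2 * d) (b + 2 * c) , λ₂≤2λ₁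
    where
    regroup : ∀ a b c d q q₀ →
      a * q + b * (q + q₀) + c * (q + 2 * q₀) + d * (q + 2 * q₀ + 1)
      ≡ (a + b + c + d) * q + (b + 2 * c + 2 * d) * q₀ + d
    regroup = solve-∀
    double : ∀ a b c d → b + 2 * c + 2 * d + (2 * a + b) ≡ 2 * (a + b + c + d)
    double = solve-∀
    λ₂≤2λ₁ : b + 2 * c + 2 * d ≤ 2 * (a + b + c + d)
    λ₂≤2λ₁ = subst (b + 2 * c + 2 * d ≤_) (double a b c d)
                   (m≤m+n (b + 2 * c + 2 * d) (2 * a + b))

  triangle-generated : ∀ l₁ l₂ l₃ → 2 * l₃ ≤ l₂ → l₂ ≤ 2 * l₁ →
    Generated (l₁ * q + l₂ * q₀ + l₃)
  triangle-generated l₁ zero zero _ _ = l₁ , 0 , 0 , 0 , only-q l₁ q q₀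
    where
    only-q : ∀ l₁ q q₀ →
      l₁ * q + 0 * q₀ + 0 ≡ l₁ * q + 0 * (q + q₀) + 0 * (q + 2 * q₀) + 0 * (q + 2 * q₀ + 1)
    only-q = solve-∀
  triangle-generated zero (suc l₂) l₃ _ ()
  triangle-generated (suc p) 1 zero _ _ = p , 1 , 0 , 0 , one-q+q₀ p q q₀
    where
    one-q+q₀ : ∀ p q q₀ →
      suc p * q + 1 * q₀ + 0 ≡ p * q + 1 * (q + q₀) + 0 * (q + 2 * q₀) + 0 * (q + 2 * q₀ + 1)
    one-q+q₀ = solve-∀
  triangle-generated (suc p) 1 (suc k) 2λ₃≤1 _ with () ← 2*suc-≰-1 k 2λ₃≤1
  triangle-generated (suc p) (suc (suc m)) zero _ λ₂≤2λ₁ =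
    subst Generated (shift p m q q₀)
      (generated-+ (triangle-generated p m 0 z≤n (2+-≤-2*suc⇒≤-2* m p λ₂≤2λ₁))
                   generated-q+2q₀)
    where
    shift : ∀ p m q q₀ →
      p * q + m * q₀ + 0 + (q + 2 * q₀) ≡ suc p * q + suc (suc m) * q₀ + 0
    shift = solve-∀
  triangle-generated (suc p) (suc (suc m)) (suc k) 2λ₃≤λ₂ λ₂≤2λ₁ =
    subst Generated (shift p m k q q₀)
      (generated-+ (triangle-generated p m k (2*suc-≤-2+⇒2*-≤ k m 2λ₃≤λ₂)
                                             (2+-≤-2*suc⇒≤-2* m p λ₂≤2λ₁))
                   generated-q+2q₀+1)
    where
    shift : ∀ p m k q q₀ →
      p * q + m * q₀ + k + (q + 2 * q₀ + 1) ≡ suc p * q + suc (suc m) * q₀ + suc k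
    shift = solve-∀

  triangular⇒generated : ∀ {n} → Triangular n → Generated n
  triangular⇒generated (l₁ , l₂ , l₃ , refl , 2λ₃≤λ₂ , λ₂≤2λ₁) =
    triangle-generated l₁ l₂ l₃ 2λ₃≤λ₂ λ₂≤2λ₁

lemma4p11 : (h : ℕ) → 1 ≤ h → (n : ℕ) → (InS h n → InT h n) × (InT h n → InS h n)
lemma4p11 h _ n = generated⇒triangular , triangular⇒generated
  where open Generators (qq h) (q₀ h)
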